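{- Let $(S,\mathcal{U})$ be a composable map such that for every $U\subseteq\mathcal{U}$ the representation of $S(U)$ uses at most $k$ bits. Then $\mathrm{rank}((S,\mathcal{U}))\le k$; that is, for every sketch $\sigma\in\{S(U):U\subseteq\mathcal{U}\}$ and every core $C$ of $\sigma$, $|C|\le k$.
   Context: A sketching map $(S,\mathcal{U})$ consists of a finite ground set $\mathcal{U}$ and a map $S:2^{\mathcal{U}}\to\Sigma$. It is composable if there is a binary operation $\oplus$ on $\Sigma$ with $S(U\cup V)=S(U)\oplus S(V)$ for all $U,V\subseteq\mathcal{U}$. A core of a sketch $\sigma$ is a subset $U\subseteq\mathcal{U}$ with $S(U)=\sigma$ such that $S(U')\neq\sigma$ for every proper subset $U'\subsetneq U$. The rank of $(S,\mathcal{U})$ is the maximum size of a core of any sketch $\sigma\in S(2^{\mathcal{U}})$. -}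

module Defs where

open import Data.Nat using (ℕ)
open import Data.Fin.Subset using (Subset; _∪_; _⊂_)
open import Data.Product using (Σ; _×_)
open import Relation.Binary.PropositionalEquality using (_≡_)
open import Relation.Nullary using (¬_)

SketchMap : ℕ → Set → Set
SketchMap n A = Subset n → A

Composable : {n : ℕ} {A : Set} → SketchMap n A → Set
Composable {n} {A} S =
  Σ (A → A → A) λ _⊕_ → ∀ (U V : Subset n) → S (U ∪ V) ≡ S U ⊕ S V

IsCore : {n : ℕ} {A : Set} → SketchMap n A → A → Subset n → Set
IsCore {n} S σ C = (S C ≡ σ) × (∀ (C' : Subset n) → C' ⊂ C → ¬ (S C' ≡ σ))

{-# OPTIONS --safe #-}
-- Let C be a core of σ. If T₁, T₂ ⊆ C have the same sketch, then replacing T₁ by T₂ in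
-- C = T₁ ∪ (C ─ T₁) does not change the sketch, by composability; minimality of C then
-- forces T₁ ⊆ T₂. So S is injective on the 2 ^ ∣ C ∣ subsets of C, and so is their
-- encoding. There are only 2 ^ (k + 1) - 1 bit strings of length at most k, hence ∣ C ∣ ≤ k.
module Submission where

open import Defs
open import Data.Bool using (Bool; true; false)
open import Data.Empty using (⊥-elim)
open import Data.Fin using (Fin; zero; suc; toℕ; fromℕ<; finToFun; funToFin; combine)
open import Data.Fin.Properties using (2↔Bool; funToFin-finToFin; toℕ-fromℕ<; injective⇒≤)
open import Data.Fin.Subset using (Subset; ∣_∣; _∈_; _∉_; _⊆_; _⊂_; _∪_; _─_; inside; outside)
open import Data.Fin.Subset.Properties
  using (_∈?_; ⊆-antisym; x∈p∪q⁻; x∈p∪q⁺; p─q⊆p; x∈p∧x∉q⇒x∈p─q)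
open import Data.List using (List; []; _∷_; length)
open import Data.Nat using (ℕ; zero; suc; s≤s; _+_; _*_; _^_; pred; _≤_; _<_)
open import Data.Nat.Binary using (ℕᵇ; 2[1+_]; 1+[2_]) renaming (zero to 0ᵇ; toℕ to toℕᵇ)
open import Data.Nat.Binary.Properties
  using (1+[2_]-injective; 2[1+_]-injective) renaming (toℕ-injective to toℕᵇ-injective)
open import Data.Nat.Properties
  using ( ≤-refl; ≤-trans; n≤1+n; *-suc; *-distribˡ-+; *-monoʳ-≤; ^-monoʳ-≤; m^n≢0
        ; <⇒≤pred; m≤pred[n]⇒suc[m]≤n; ≮⇒≥; <⇒≱; module ≤-Reasoning)
open import Data.Product using (_,_; proj₁)
open import Data.Sum using (inj₁; inj₂; [_,_]′)
open import Data.Vec using ([]; _∷_; here; there; tabulate; lookup)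
open import Data.Vec.Properties using (∷-injective; ∷-injectiveʳ; lookup∘tabulate)
open import Function using (_∘_; Injective)
open import Function.Bundles using (Inverse; Injection)
open import Function.Properties.Inverse using (Inverse⇒Injection)
open import Relation.Binary.PropositionalEquality
  using (_≡_; refl; sym; trans; cong; cong₂; _≗_; module ≡-Reasoning)
open import Relation.Nullary using (¬_; yes; no; contradiction)

private
  variable
    n m k : ℕ
    A : Set
    x : Fin n
    p q r : Subset n

x∈p─q⇒x∉q : x ∈ p ─ q → x ∉ q
x∈p─q⇒x∉q {p = _ ∷ _} {q = outside ∷ _} here        ()
x∈p─q⇒x∉q {p = _ ∷ _} {q = _       ∷ _} (there x∈) (there x∈q) = x∈p─q⇒x∉q x∈ x∈q

∪-lub : p ⊆ r → q ⊆ r → p ∪ q ⊆ r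
∪-lub {p = p} {q = q} p⊆r q⊆r x∈p∪q = [ p⊆r , q⊆r ]′ (x∈p∪q⁻ p q x∈p∪q)

p⊆q⇒p∪[q─p]≡q : p ⊆ q → p ∪ (q ─ p) ≡ q
p⊆q⇒p∪[q─p]≡q {p = p} {q = q} p⊆q = ⊆-antisym (∪-lub p⊆q (p─q⊆p q p)) q⊆p∪[q─p]
  where
  q⊆p∪[q─p] : q ⊆ p ∪ (q ─ p)
  q⊆p∪[q─p] {x} x∈q with x ∈? p
  ... | yes x∈p = x∈p∪q⁺ (inj₁ x∈p)
  ... | no  x∉p = x∈p∪q⁺ (inj₂ (x∈p∧x∉q⇒x∈p─q x∈q x∉p))

⊆∧⊄⇒⊇ : p ⊆ q → ¬ (p ⊂ q) → q ⊆ p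
⊆∧⊄⇒⊇ {p = p} p⊆q p⊄q {x} x∈q with x ∈? p
... | yes x∈p = x∈p
... | no  x∉p = ⊥-elim (p⊄q (p⊆q , x , x∈q , x∉p))

spread : (C : Subset n) → Subset ∣ C ∣ → Subset n
spread []            p       = []
spread (outside ∷ C) p       = outside ∷ spread C p
spread (inside  ∷ C) (b ∷ p) = b ∷ spread C p

spread-⊆ : (C : Subset n) (p : Subset ∣ C ∣) → spread C p ⊆ C
spread-⊆ (outside ∷ C) p       (there x∈) = there (spread-⊆ C p x∈)
spread-⊆ (inside  ∷ C) (b ∷ p) here       = here
spread-⊆ (inside  ∷ C) (b ∷ p) (there x∈) = there (spread-⊆ C p x∈)

spread-injective : (C : Subset n) → Injective _≡_ _≡_ (spread C)
spread-injective []            {[]}    {[]}    _  = refl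
spread-injective (outside ∷ C)                 eq = spread-injective C (∷-injectiveʳ eq)
spread-injective (inside  ∷ C) {b ∷ p} {c ∷ q} eq with ∷-injective eq
... | b≡c , eq′ = cong₂ _∷_ b≡c (spread-injective C eq′)

module _ {S : SketchMap n A} where

  core-minimal : ∀ {σ C C′} → IsCore S σ C → C′ ⊆ C → S C′ ≡ σ → C ⊆ C′
  core-minimal (_ , minimal) C′⊆C SC′≡σ = ⊆∧⊄⇒⊇ C′⊆C (λ C′⊂C → minimal _ C′⊂C SC′≡σ)

  sketch-swap : ∀ {C T₁ T₂} → Composable S → T₁ ⊆ C → S T₁ ≡ S T₂ → S (T₂ ∪ (C ─ T₁)) ≡ S C
  sketch-swap {C} {T₁} {T₂} (_⊕_ , S-∪) T₁⊆C ST₁≡ST₂ = begin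
    S (T₂ ∪ (C ─ T₁))  ≡⟨ S-∪ T₂ (C ─ T₁) ⟩
    S T₂ ⊕ S (C ─ T₁)  ≡⟨ cong (_⊕ S (C ─ T₁)) (sym ST₁≡ST₂) ⟩
    S T₁ ⊕ S (C ─ T₁)  ≡⟨ S-∪ T₁ (C ─ T₁) ⟨
    S (T₁ ∪ (C ─ T₁))  ≡⟨ cong S (p⊆q⇒p∪[q─p]≡q T₁⊆C) ⟩
    S C                ∎
    where open ≡-Reasoning

  core-sketch-⊆ : ∀ {σ C T₁ T₂} → Composable S → IsCore S σ C →
                  T₁ ⊆ C → T₂ ⊆ C → S T₁ ≡ S T₂ → T₁ ⊆ T₂
  core-sketch-⊆ {C = C} {T₁} {T₂} composable core T₁⊆C T₂⊆C ST₁≡ST₂ x∈T₁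
    with x∈p∪q⁻ T₂ (C ─ T₁) (C⊆T₂∪[C─T₁] (T₁⊆C x∈T₁))
    where
    C⊆T₂∪[C─T₁] : C ⊆ T₂ ∪ (C ─ T₁)
    C⊆T₂∪[C─T₁] = core-minimal core (∪-lub T₂⊆C (p─q⊆p C T₁))
                                    (trans (sketch-swap composable T₁⊆C ST₁≡ST₂) (proj₁ core))
  ... | inj₁ x∈T₂   = x∈T₂
  ... | inj₂ x∈C─T₁ = contradiction x∈T₁ (x∈p─q⇒x∉q x∈C─T₁)

  core-sketch-injective : ∀ {σ C T₁ T₂} → Composable S → IsCore S σ C →
                          T₁ ⊆ C → T₂ ⊆ C → S T₁ ≡ S T₂ → T₁ ≡ T₂
  core-sketch-injective composable core T₁⊆C T₂⊆C ST₁≡ST₂ =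
    ⊆-antisym (core-sketch-⊆ composable core T₁⊆C T₂⊆C ST₁≡ST₂)
              (core-sketch-⊆ composable core T₂⊆C T₁⊆C (sym ST₁≡ST₂))

bits : List Bool → ℕᵇ
bits []           = 0ᵇ
bits (false ∷ bs) = 1+[2 bits bs ]
bits (true  ∷ bs) = 2[1+ bits bs ]

bits-injective : Injective _≡_ _≡_ bits
bits-injective {[]}         {[]}         _  = refl
bits-injective {false ∷ bs} {false ∷ cs} eq = cong (false ∷_) (bits-injective (1+[2_]-injective eq))
bits-injective {true  ∷ bs} {true  ∷ cs} eq = cong (true ∷_) (bits-injective (2[1+_]-injective eq))
bits-injective {[]}         {false ∷ _}  ()
bits-injective {[]}         {true  ∷ _}  ()
bits-injective {false ∷ _}  {[]}         ()
bits-injective {false ∷ _}  {true  ∷ _}  ()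
bits-injective {true  ∷ _}  {[]}         ()
bits-injective {true  ∷ _}  {false ∷ _}  ()

2+bits-∷-≤ : ∀ b bs → 2 + toℕᵇ (bits (b ∷ bs)) ≤ 2 * (2 + toℕᵇ (bits bs))
2+bits-∷-≤ false bs = begin
  3 + 2 * v    ≤⟨ n≤1+n _ ⟩
  4 + 2 * v    ≡⟨ *-distribˡ-+ 2 2 v ⟨
  2 * (2 + v)  ∎
  where open ≤-Reasoning; v = toℕᵇ (bits bs)
2+bits-∷-≤ true bs = begin
  2 + 2 * (1 + v)  ≡⟨ cong (2 +_) (*-suc 2 v) ⟩
  4 + 2 * v        ≡⟨ *-distribˡ-+ 2 2 v ⟨
  2 * (2 + v)      ∎
  where open ≤-Reasoning; v = toℕᵇ (bits bs)

2+bits-≤ : ∀ bs → 2 + toℕᵇ (bits bs) ≤ 2 ^ suc (length bs)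
2+bits-≤ []       = ≤-refl
2+bits-≤ (b ∷ bs) = ≤-trans (2+bits-∷-≤ b bs) (*-monoʳ-≤ 2 (2+bits-≤ bs))

funToFin-cong : {f g : Fin m → Fin n} → f ≗ g → funToFin f ≡ funToFin g
funToFin-cong {m = zero}  f≗g = refl
funToFin-cong {m = suc m} f≗g = cong₂ combine (f≗g zero) (funToFin-cong (f≗g ∘ suc))

finToFun-injective : ∀ {m n} {i j : Fin (m ^ n)} → finToFun {m} {n} i ≗ finToFun j → i ≡ j
finToFun-injective {m} {n} {i} {j} eq = begin
  i                              ≡⟨ funToFin-finToFin {n} {m} i ⟨
  funToFin (finToFun {m} {n} i)  ≡⟨ funToFin-cong eq ⟩
  funToFin (finToFun {m} {n} j)  ≡⟨ funToFin-finToFin {n} {m} j ⟩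
  j                              ∎
  where open ≡-Reasoning

finToSubset : Fin (2 ^ m) → Subset m
finToSubset {m} i = tabulate (Inverse.to 2↔Bool ∘ finToFun {2} {m} i)

finToSubset-injective : Injective _≡_ _≡_ (finToSubset {m})
finToSubset-injective {m} {i} {j} eq = finToFun-injective λ x →
  Injection.injective (Inverse⇒Injection 2↔Bool) (begin
    Inverse.to 2↔Bool (finToFun {2} {m} i x)  ≡⟨ lookup∘tabulate _ x ⟨
    lookup (finToSubset {m} i) x              ≡⟨ cong (λ p → lookup p x) eq ⟩
    lookup (finToSubset {m} j) x              ≡⟨ lookup∘tabulate _ x ⟩
    Inverse.to 2↔Bool (finToFun {2} {m} j x)  ∎)
  where open ≡-Reasoning

short-code⇒< : ∀ {a} (code : Fin a → List Bool) → Injective _≡_ _≡_ code →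
               (∀ i → length (code i) ≤ k) → a < 2 ^ suc k
short-code⇒< {k} {a} code code-injective short =
  m≤pred[n]⇒suc[m]≤n {{m^n≢0 2 (suc k)}} (injective⇒≤ value-injective)
  where
  value< : ∀ i → toℕᵇ (bits (code i)) < pred (2 ^ suc k)
  value< i = <⇒≤pred (≤-trans (2+bits-≤ (code i)) (^-monoʳ-≤ 2 (s≤s (short i))))

  value : Fin a → Fin (pred (2 ^ suc k))
  value i = fromℕ< (value< i)

  value-injective : Injective _≡_ _≡_ value
  value-injective {i} {j} eq = code-injective (bits-injective (toℕᵇ-injective (begin
    toℕᵇ (bits (code i))  ≡⟨ toℕ-fromℕ< (value< i) ⟨
    toℕ (value i)         ≡⟨ cong toℕ eq ⟩
    toℕ (value j)         ≡⟨ toℕ-fromℕ< (value< j) ⟩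
    toℕᵇ (bits (code j))  ∎)))
    where open ≡-Reasoning

short-subset-code⇒≤ : (code : Subset m → List Bool) → Injective _≡_ _≡_ code →
                      (∀ p → length (code p) ≤ k) → m ≤ k
short-subset-code⇒≤ {m} {k} code code-injective short =
  ≮⇒≥ λ k<m → <⇒≱ 2^m<2^[1+k] (^-monoʳ-≤ 2 k<m)
  where
  2^m<2^[1+k] : 2 ^ m < 2 ^ suc k
  2^m<2^[1+k] = short-code⇒< (code ∘ finToSubset)
                             (λ eq → finToSubset-injective (code-injective eq))
                             (short ∘ finToSubset)

mainTheorem3 : (n k : ℕ) (A : Set) (S : SketchMap n A) →
    Composable S →
    (enc : A → List Bool) →
    (∀ (U V : Subset n) → enc (S U) ≡ enc (S V) → S U ≡ S V) →
    (∀ (U : Subset n) → length (enc (S U)) ≤ k) →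
    ∀ (U C : Subset n) → IsCore S (S U) C → ∣ C ∣ ≤ k
mainTheorem3 n k A S composable enc enc-injective short U C core =
  short-subset-code⇒≤ code code-injective (λ p → short (spread C p))
  where
  code : Subset ∣ C ∣ → List Bool
  code p = enc (S (spread C p))

  code-injective : Injective _≡_ _≡_ code
  code-injective {p} {q} eq = spread-injective C
    (core-sketch-injective composable core (spread-⊆ C p) (spread-⊆ C q) (enc-injective _ _ eq))
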